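{- For any positive integer $n$ and any $1\leq i\leq n$, \[ \mathbf{B}_{n,-i}(t)=t^n\,\mathbf{B}_{n,i}(t^{ -1}). \]
   Context: $\mathfrak{B}_n$ is the set of signed permutations $\pi=\pi_1\cdots\pi_n$ of $[n]$. With $\pi_0=0$, $\mathrm{des}_B(\pi)=|\{k\in\{0,\dots,n-1\}:\pi_k>\pi_{k+1}\}|$. For $j\in\{\pm1,\dots,\pm n\}$, $\mathfrak{B}_{n,j}=\{\pi\in\mathfrak{B}_n:\pi_n=j\}$ and $\mathbf{B}_{n,j}(t)=\sum_{\pi\in\mathfrak{B}_{n,j}}t^{\mathrm{des}_B(\pi)}$. -}

module Defs where

open import Data.Bool using (Bool; true; false; _∧_; if_then_else_)
open import Data.Nat as ℕ using (ℕ; zero; suc)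
open import Data.Integer as ℤ using (ℤ; +_; -_; ∣_∣)
open import Data.Rational as ℚ using (ℚ; 0ℚ; 1ℚ)
open import Data.List using (List; []; _∷_; map; concatMap; foldr; filterᵇ; last; upTo)
import Data.List.Relation.Unary.Unique.DecPropositional as UniqueDec
open import Data.Maybe using (Maybe; just; nothing)
open import Relation.Nullary using (does)

signedLetters : ℕ → List ℤ
signedLetters n = concatMap (λ k → + suc k ∷ - (+ suc k) ∷ []) (upTo n)

words : List ℤ → ℕ → List (List ℤ)
words A zero    = [] ∷ []
words A (suc m) = concatMap (λ a → map (a ∷_) (words A m)) A

-- A signed permutation of [n] is a word π₁⋯πₙ of length n with letters in
-- {±1,…,±n} whose absolute values |π₁|,…,|πₙ| are pairwise distinct
-- (hence form a permutation of [n]).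
isSignedPerm : List ℤ → Bool
isSignedPerm π = does (UniqueDec.unique? ℕ._≟_ (map ∣_∣ π))

-- 𝔅ₙ as an explicit (duplicate-free) list.
𝔅 : ℕ → List (List ℤ)
𝔅 n = filterᵇ isSignedPerm (words (signedLetters n) n)

descents : List ℤ → ℕ
descents []             = 0
descents (x ∷ [])       = 0
descents (x ∷ y ∷ rest) = (if does (y ℤ.<? x) then 1 else 0) ℕ.+ descents (y ∷ rest)

-- des_B(π) with the convention π₀ = 0.
desB : List ℤ → ℕ
desB π = descents (+ 0 ∷ π)

endsWith : ℤ → List ℤ → Bool
endsWith j π with last π
... | just x  = does (x ℤ.≟ j)
... | nothing = false

𝔅′ : ℕ → ℤ → List (List ℤ)
𝔅′ n j = filterᵇ (endsWith j) (𝔅 n)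

_^_ : ℚ → ℕ → ℚ
t ^ zero  = 1ℚ
t ^ suc k = t ℚ.* (t ^ k)

𝐁 : ℕ → ℤ → ℚ → ℚ
𝐁 n j t = foldr (λ π acc → (t ^ desB π) ℚ.+ acc) 0ℚ (𝔅′ n j)

{-# OPTIONS --safe #-}
-- Negating every letter, π ↦ −π, is an involution of the words over {±1,…,±n}
-- that preserves being a signed permutation and sends last letter j to −j.
-- The letters of 0 π₁ ⋯ πₙ are pairwise distinct, so each of its n adjacent
-- pairs is a descent of exactly one of π and −π: des_B(−π) = n − des_B(π).
-- Reindexing the sum defining 𝐁_{n,−j} by this involution gives the identity.
module Submission where

open import Defs
open import Data.Nat using (ℕ; _≤_)
open import Data.Integer using (+_; -_)
open import Data.Rational using (ℚ; NonZero; 1/_)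
open import Relation.Binary.PropositionalEquality using (_≡_)

open import Algebra.Bundles using (CommutativeMonoid)
import Algebra.Properties.CommutativeSemigroup as CommSemigroupProperties
open import Data.Bool using (Bool; true; false; if_then_else_)
open import Data.Nat as ℕ using (zero; suc)
import Data.Nat.Properties as ℕ
open import Data.Integer as ℤ using (ℤ; ∣_∣)
import Data.Integer.Properties as ℤ
open import Data.Rational as ℚ using (0ℚ; 1ℚ)
import Data.Rational.Properties as ℚ
open import Data.List using (List; []; _∷_; map; concatMap; foldr; filterᵇ; last; upTo; length; _++_)
open import Data.List.Properties using (map-∘; map-cong; last-map)
open import Data.List.Relation.Unary.All as All using (All; []; _∷_)
import Data.List.Relation.Unary.All.Properties as All
open import Data.List.Relation.Unary.Linked using (Linked; [-]; _∷_)
open import Data.List.Relation.Unary.AllPairs using (_∷_)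
open import Data.List.Relation.Unary.Linked.Properties using (AllPairs⇒Linked)
open import Data.List.Relation.Unary.Unique.Propositional using (Unique)
import Data.List.Relation.Unary.Unique.Propositional.Properties as Unique
import Data.List.Relation.Unary.Unique.DecPropositional as UniqueDec
open import Data.Maybe using (just; nothing; maybe′)
open import Data.Product using (_×_; _,_)
open import Function using (_∘_; mk⇔)
open import Relation.Nullary using (yes; no; does; contradiction)
open import Relation.Nullary.Decidable using (does-⇔)
open import Relation.Binary.PropositionalEquality using (refl; sym; trans; cong; cong₂; _≢_)
open Relation.Binary.PropositionalEquality.≡-Reasoning

module ℕ+ = CommSemigroupProperties ℕ.+-commutativeSemigroup
module ℚ+ = CommSemigroupProperties (CommutativeMonoid.commutativeSemigroup ℚ.+-0-commutativeMonoid)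
module ℚ* = CommSemigroupProperties (CommutativeMonoid.commutativeSemigroup ℚ.*-1-commutativeMonoid)

private variable A B : Set

sumℚ : (A → ℚ) → List A → ℚ
sumℚ f = foldr (λ x acc → f x ℚ.+ acc) 0ℚ

sum-cong : {f g : A → ℚ} (xs : List A) → (∀ x → f x ≡ g x) → sumℚ f xs ≡ sumℚ g xs
sum-cong []       f≗g = refl
sum-cong (x ∷ xs) f≗g = cong₂ ℚ._+_ (f≗g x) (sum-cong xs f≗g)

sum-cong-All : {f g : A → ℚ} {xs : List A} → All (λ x → f x ≡ g x) xs → sumℚ f xs ≡ sumℚ g xs
sum-cong-All []           = refl
sum-cong-All (fx≡gx ∷ eq) = cong₂ ℚ._+_ fx≡gx (sum-cong-All eq)

sum-filter : (P : A → Bool) (f : A → ℚ) (xs : List A) →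
             sumℚ f (filterᵇ P xs) ≡ sumℚ (λ x → if P x then f x else 0ℚ) xs
sum-filter P f [] = refl
sum-filter P f (x ∷ xs) with P x
... | true  = cong (f x ℚ.+_) (sum-filter P f xs)
... | false = trans (sum-filter P f xs) (sym (ℚ.+-identityˡ _))

sum-++ : (f : A → ℚ) (xs ys : List A) → sumℚ f (xs ++ ys) ≡ sumℚ f xs ℚ.+ sumℚ f ys
sum-++ f []       ys = sym (ℚ.+-identityˡ _)
sum-++ f (x ∷ xs) ys = trans (cong (f x ℚ.+_) (sum-++ f xs ys)) (sym (ℚ.+-assoc (f x) _ _))

*-distribˡ-sum : (c : ℚ) (f : A → ℚ) (xs : List A) → c ℚ.* sumℚ f xs ≡ sumℚ (λ x → c ℚ.* f x) xs
*-distribˡ-sum c f []       = ℚ.*-zeroʳ c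
*-distribˡ-sum c f (x ∷ xs) = trans (ℚ.*-distribˡ-+ c (f x) _) (cong (c ℚ.* f x ℚ.+_) (*-distribˡ-sum c f xs))

sum-map : (f : B → ℚ) (g : A → B) (xs : List A) → sumℚ f (map g xs) ≡ sumℚ (f ∘ g) xs
sum-map f g []       = refl
sum-map f g (x ∷ xs) = cong (f (g x) ℚ.+_) (sum-map f g xs)

sum-concatMap : (f : B → ℚ) (g : A → List B) (xs : List A) →
                sumℚ f (concatMap g xs) ≡ sumℚ (sumℚ f ∘ g) xs
sum-concatMap f g []       = refl
sum-concatMap f g (x ∷ xs) =
  trans (sum-++ f (g x) (concatMap g xs)) (cong (sumℚ f (g x) ℚ.+_) (sum-concatMap f g xs))

SumInvariantUnder : (A → A) → List A → Set
SumInvariantUnder f xs = ∀ g → sumℚ (g ∘ f) xs ≡ sumℚ g xs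

sum-words-suc : (h : List ℤ → ℚ) (A : List ℤ) (m : ℕ) →
                sumℚ h (words A (suc m)) ≡ sumℚ (λ a → sumℚ (h ∘ (a ∷_)) (words A m)) A
sum-words-suc h A m = trans (sum-concatMap h (λ a → map (a ∷_) (words A m)) A)
                            (sum-cong A (λ a → sum-map h (a ∷_) (words A m)))

words-invariant : {f : ℤ → ℤ} {A : List ℤ} → SumInvariantUnder f A →
                  ∀ m → SumInvariantUnder (map f) (words A m)
words-invariant         invA zero    h = refl
words-invariant {f} {A} invA (suc m) h = begin
  sumℚ (h ∘ map f) (words A (suc m))                  ≡⟨ sum-words-suc (h ∘ map f) A m ⟩
  sumℚ (λ a → sumℚ (λ w → h (f a ∷ map f w)) W) A     ≡⟨ sum-cong A (λ a → words-invariant invA m (h ∘ (f a ∷_))) ⟩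
  sumℚ (λ a → sumℚ (h ∘ (f a ∷_)) W) A                ≡⟨ invA (λ a → sumℚ (h ∘ (a ∷_)) W) ⟩
  sumℚ (λ a → sumℚ (h ∘ (a ∷_)) W) A                  ≡⟨ sym (sum-words-suc h A m) ⟩
  sumℚ h (words A (suc m))                            ∎
  where W = words A m

signedLetters-invariant : ∀ n → SumInvariantUnder -_ (signedLetters n)
signedLetters-invariant n = go (upTo n)
  where
  go : (ks : List ℕ) → SumInvariantUnder -_ (concatMap (λ k → + suc k ∷ - (+ suc k) ∷ []) ks)
  go []       g = refl
  -- − − (+ suc k) reduces to + suc k, so negation merely swaps the two letters of each pair.
  go (k ∷ ks) g = trans (cong (λ r → g (- (+ suc k)) ℚ.+ (g (+ suc k) ℚ.+ r)) (go ks g))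
                        (ℚ+.x∙yz≈y∙xz (g (- (+ suc k))) (g (+ suc k)) _)

signedLetters-nonzero : ∀ n → All (+ 0 ≢_) (signedLetters n)
signedLetters-nonzero n = go (upTo n)
  where
  go : (ks : List ℕ) → All (+ 0 ≢_) (concatMap (λ k → + suc k ∷ - (+ suc k) ∷ []) ks)
  go []       = []
  go (k ∷ ks) = (λ ()) ∷ (λ ()) ∷ go ks

words-All : {P : ℤ → Set} {A : List ℤ} → All P A →
            ∀ m → All (λ w → length w ≡ m × All P w) (words A m)
words-All             pA zero    = (refl , []) ∷ []
words-All {P = P} {A} pA (suc m) = All.concat⁺ (All.map⁺ (All.map prepend pA))
  where
  prepend : {a : ℤ} → P a → All (λ w → length w ≡ suc m × All P w) (map (a ∷_) (words A m))
  prepend pa = All.map⁺ (All.map (λ { (len , pw) → cong suc len , pa ∷ pw }) (words-All pA m))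

isDescent : ℤ → ℤ → ℕ
isDescent x y = if does (y ℤ.<? x) then 1 else 0

isDescent-neg : {x y : ℤ} → x ≢ y → isDescent (- x) (- y) ℕ.+ isDescent x y ≡ 1
isDescent-neg {x} {y} x≢y with (- y) ℤ.<? (- x) | y ℤ.<? x
... | yes -y<-x | yes y<x = contradiction (ℤ.neg-mono-< y<x) (ℤ.<-asym -y<-x)
... | yes _     | no _    = refl
... | no _      | yes _   = refl
... | no -y≮-x  | no y≮x  = contradiction (ℤ.≤-antisym (ℤ.≮⇒≥ y≮x) (ℤ.≮⇒≥ (-y≮-x ∘ ℤ.neg-mono-<))) x≢y

descents-neg : {x : ℤ} {xs : List ℤ} → Linked _≢_ (x ∷ xs) →
               descents (map -_ (x ∷ xs)) ℕ.+ descents (x ∷ xs) ≡ length xs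
descents-neg             [-]                  = refl
descents-neg {x} {y ∷ ys} (x≢y ∷ linked) = begin
  (isDescent (- x) (- y) ℕ.+ descents (map -_ (y ∷ ys))) ℕ.+ (isDescent x y ℕ.+ descents (y ∷ ys))
    ≡⟨ ℕ+.interchange (isDescent (- x) (- y)) _ (isDescent x y) _ ⟩
  (isDescent (- x) (- y) ℕ.+ isDescent x y) ℕ.+ (descents (map -_ (y ∷ ys)) ℕ.+ descents (y ∷ ys))
    ≡⟨ cong₂ ℕ._+_ (isDescent-neg x≢y) (descents-neg linked) ⟩
  suc (length ys) ∎

^-homo-+ : (t : ℚ) (m n : ℕ) → t ^ (m ℕ.+ n) ≡ t ^ m ℚ.* t ^ n
^-homo-+ t zero    n = sym (ℚ.*-identityˡ _)
^-homo-+ t (suc m) n = trans (cong (t ℚ.*_) (^-homo-+ t m n)) (sym (ℚ.*-assoc t (t ^ m) (t ^ n)))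

^-*-1/^ : (t : ℚ) .{{_ : NonZero t}} (n : ℕ) → t ^ n ℚ.* (1/ t) ^ n ≡ 1ℚ
^-*-1/^ t zero    = refl
^-*-1/^ t (suc n) = begin
  (t ℚ.* t ^ n) ℚ.* ((1/ t) ℚ.* (1/ t) ^ n) ≡⟨ ℚ*.interchange t (t ^ n) (1/ t) ((1/ t) ^ n) ⟩
  (t ℚ.* 1/ t) ℚ.* (t ^ n ℚ.* (1/ t) ^ n)   ≡⟨ cong₂ ℚ._*_ (ℚ.*-inverseʳ t) (^-*-1/^ t n) ⟩
  1ℚ ℚ.* 1ℚ                                 ≡⟨ ℚ.*-identityˡ 1ℚ ⟩
  1ℚ                                        ∎

^-+-*-1/^ : (t : ℚ) .{{_ : NonZero t}} (m n : ℕ) → t ^ (m ℕ.+ n) ℚ.* (1/ t) ^ n ≡ t ^ m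
^-+-*-1/^ t m n = begin
  t ^ (m ℕ.+ n) ℚ.* (1/ t) ^ n           ≡⟨ cong (ℚ._* (1/ t) ^ n) (^-homo-+ t m n) ⟩
  (t ^ m ℚ.* t ^ n) ℚ.* (1/ t) ^ n       ≡⟨ ℚ.*-assoc (t ^ m) (t ^ n) _ ⟩
  t ^ m ℚ.* (t ^ n ℚ.* (1/ t) ^ n)       ≡⟨ cong (t ^ m ℚ.*_) (^-*-1/^ t n) ⟩
  t ^ m ℚ.* 1ℚ                           ≡⟨ ℚ.*-identityʳ (t ^ m) ⟩
  t ^ m                                  ∎

isSignedPerm-neg : (π : List ℤ) → isSignedPerm (map -_ π) ≡ isSignedPerm π
isSignedPerm-neg π = cong (does ∘ UniqueDec.unique? ℕ._≟_)
                          (trans (sym (map-∘ π)) (map-cong ℤ.∣-i∣≡∣i∣ π))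

isSignedPerm⇒Unique : {π : List ℤ} → isSignedPerm π ≡ true → Unique (map ∣_∣ π)
isSignedPerm⇒Unique {π} isSP with UniqueDec.unique? ℕ._≟_ (map ∣_∣ π)
... | yes unique = unique

signedPerm-linked : {π : List ℤ} → isSignedPerm π ≡ true → All (+ 0 ≢_) π → Linked _≢_ (+ 0 ∷ π)
signedPerm-linked isSP nonzero = AllPairs⇒Linked (nonzero ∷ Unique.map⁻ (isSignedPerm⇒Unique isSP))

endsWith-last : (j : ℤ) (π : List ℤ) → endsWith j π ≡ maybe′ (λ x → does (x ℤ.≟ j)) false (last π)
endsWith-last j π with last π
... | just x  = refl
... | nothing = refl

endsWith-neg : (j : ℤ) (π : List ℤ) → endsWith (- j) (map -_ π) ≡ endsWith j π
endsWith-neg j π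
  rewrite endsWith-last (- j) (map -_ π) | last-map -_ π | endsWith-last j π
  with last π
... | just x  = does-⇔ (mk⇔ ℤ.neg-injective (cong -_)) (- x ℤ.≟ - j) (x ℤ.≟ j)
... | nothing = refl

weight : ℤ → ℚ → List ℤ → ℚ
weight j t π = if isSignedPerm π then (if endsWith j π then t ^ desB π else 0ℚ) else 0ℚ

𝐁-as-sum : (n : ℕ) (j : ℤ) (t : ℚ) → 𝐁 n j t ≡ sumℚ (weight j t) (words (signedLetters n) n)
𝐁-as-sum n j t =
  trans (sum-filter (endsWith j) (λ π → t ^ desB π) (filterᵇ isSignedPerm W))
        (sum-filter isSignedPerm (λ π → if endsWith j π then t ^ desB π else 0ℚ) W)
  where W = words (signedLetters n) n

weight-neg : {n : ℕ} (j : ℤ) (t : ℚ) .{{_ : NonZero t}} {π : List ℤ} →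
             length π ≡ n → All (+ 0 ≢_) π →
             weight (- j) t (map -_ π) ≡ t ^ n ℚ.* weight j (1/ t) π
weight-neg {n} j t {π} refl nonzero
  rewrite isSignedPerm-neg π | endsWith-neg j π
  with isSignedPerm π in isSP | endsWith j π
... | false | _     = sym (ℚ.*-zeroʳ (t ^ n))
... | true  | false = sym (ℚ.*-zeroʳ (t ^ n))
... | true  | true  = begin
  t ^ desB (map -_ π)                                    ≡⟨ sym (^-+-*-1/^ t (desB (map -_ π)) (desB π)) ⟩
  t ^ (desB (map -_ π) ℕ.+ desB π) ℚ.* (1/ t) ^ desB π   ≡⟨ cong (λ k → t ^ k ℚ.* (1/ t) ^ desB π) desB-sum ⟩
  t ^ n ℚ.* (1/ t) ^ desB π                              ∎
  where
  desB-sum : desB (map -_ π) ℕ.+ desB π ≡ n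
  desB-sum = descents-neg (signedPerm-linked isSP nonzero)

𝐁-neg : (n : ℕ) (j : ℤ) (t : ℚ) .{{_ : NonZero t}} → 𝐁 n (- j) t ≡ t ^ n ℚ.* 𝐁 n j (1/ t)
𝐁-neg n j t = begin
  𝐁 n (- j) t                                 ≡⟨ 𝐁-as-sum n (- j) t ⟩
  sumℚ (weight (- j) t) W                     ≡⟨ sym (words-invariant (signedLetters-invariant n) n (weight (- j) t)) ⟩
  sumℚ (weight (- j) t ∘ map -_) W            ≡⟨ sum-cong-All (All.map pointwise (words-All (signedLetters-nonzero n) n)) ⟩
  sumℚ (λ π → t ^ n ℚ.* weight j (1/ t) π) W  ≡⟨ sym (*-distribˡ-sum (t ^ n) (weight j (1/ t)) W) ⟩
  t ^ n ℚ.* sumℚ (weight j (1/ t)) W          ≡⟨ cong (t ^ n ℚ.*_) (sym (𝐁-as-sum n j (1/ t))) ⟩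
  t ^ n ℚ.* 𝐁 n j (1/ t)                      ∎
  where
  W = words (signedLetters n) n
  pointwise : {π : List ℤ} → length π ≡ n × All (+ 0 ≢_) π →
              weight (- j) t (map -_ π) ≡ t ^ n ℚ.* weight j (1/ t) π
  pointwise (len , nonzero) = weight-neg j t len nonzero

-- The identity holds for every j ∈ ℤ.
lemma2p4 : (n i : ℕ) → 1 ≤ i → i ≤ n → (t : ℚ) → .{{_ : NonZero t}} →
           𝐁 n (- (+ i)) t ≡ (t ^ n) Data.Rational.* 𝐁 n (+ i) (1/ t)
lemma2p4 n i _ _ t = 𝐁-neg n (+ i) t
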